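{- Checking satisfiability of $\mathcal{L}^{\mathit{dyn}}$-formulas relative to the class $\mathbf{MCM}$ is decidable.
   Context: Let $\mathit{Atm}_0$ be a countable set of atomic propositions and $\mathit{Val}$ a finite set of output values; decision atoms $\mathsf{t}(x)$ for $x\in\mathit{Val}$. Language $\mathcal{L}^{\mathit{dyn}}$: $\varphi ::= p \mid \mathsf{t}(x)\mid \neg\varphi\mid \varphi\wedge\varphi\mid \Box_{\mathtt{I}}\varphi\mid \Box_{\mathtt{F}}\varphi\mid[\varphi]\psi$ ($p\in\mathit{Atm}_0$, $x\in\mathit{Val}$). A multi-classifier model (MCM) is a pair $\Gamma=(S,\Phi)$ with $S\subseteq 2^{\mathit{Atm}_0}$ and $\Phi$ a set of functions from $S$ to $\mathit{Val}$. For $s\in S$, $f\in\Phi$: $(\Gamma,s,f)\models p$ iff $p\in s$; $(\Gamma,s,f)\models\mathsf{t}(x)$ iff $f(s)=x$; Boolean connectives as usual; $(\Gamma,s,f)\models\Box_{\mathtt{I}}\varphi$ iff $(\Gamma,s',f)\models\varphi$ for all $s'\in S$; $(\Gamma,s,f)\models\Box_{\mathtt{F}}\varphi$ iff $(\Gamma,s,f')\models\varphi$ for all $f'\in\Phi$; $(\Gamma,s,f)\models[\varphi]\psi$ iff, if $(\Gamma,s,f)\models\Box_{\mathtt{I}}\varphi$ then $(\Gamma^\varphi,s,f)\models\psi$, where $\Gamma^\varphi=(S,\Phi^\varphi)$ with $\Phi^\varphi=\{f'\in\Phi:\forall s'\in S,\ (\Gamma,s',f')\models\varphi\}$. A formula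 is satisfiable relative to $\mathbf{MCM}$ if it is true at some $(\Gamma,s,f)$ with $s\in S$, $f\in\Phi$. -}

module Defs where

open import Data.Nat using (ℕ)
open import Data.Fin using (Fin)
open import Data.Bool using (Bool; true)
open import Data.Product using (Σ; _×_; ∃)
open import Data.Empty using (⊥)
open import Relation.Binary.PropositionalEquality using (_≡_)
open import Relation.Nullary using (¬_)

-- Atomic propositions Atm₀ = ℕ (countable); output values Val = Fin n (finite).
-- Language L^dyn, parameterised by the number n of output values.
data Form (n : ℕ) : Set where
  atom : ℕ → Form n
  t    : Fin n → Form n
  ¬'   : Form n → Form n
  _∧'_ : Form n → Form n → Form n
  □I   : Form n → Form n
  □F   : Form n → Form n
  [_]_ : Form n → Form n → Form n

-- A state is a subset of Atm₀, represented by its characteristic function.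
State : Set
State = ℕ → Bool

-- Multi-classifier model Γ = (S, Φ): S a set of states, Φ a set of
-- classifiers (functions from states to Val; only their values on S matter).
record MCM (n : ℕ) : Set₁ where
  constructor mcm
  field
    S : State → Set
    Φ : (State → Fin n) → Set

open MCM public

mutual
  _,_,_⊨_ : {n : ℕ} → MCM n → State → (State → Fin n) → Form n → Set
  Γ , s , f ⊨ atom p    = s p ≡ true
  Γ , s , f ⊨ t x       = f s ≡ x
  Γ , s , f ⊨ ¬' φ      = ¬ (Γ , s , f ⊨ φ)
  Γ , s , f ⊨ (φ ∧' ψ)  = (Γ , s , f ⊨ φ) × (Γ , s , f ⊨ ψ)
  Γ , s , f ⊨ □I φ      = ∀ s' → S Γ s' → Γ , s' , f ⊨ φ
  Γ , s , f ⊨ □F φ      = ∀ f' → Φ Γ f' → Γ , s , f' ⊨ φ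
  Γ , s , f ⊨ ([ φ ] ψ) = (∀ s' → S Γ s' → Γ , s' , f ⊨ φ) → update Γ φ , s , f ⊨ ψ

  update : {n : ℕ} → MCM n → Form n → MCM n
  update Γ φ = mcm (S Γ) (λ f' → Φ Γ f' × (∀ s' → S Γ s' → Γ , s' , f' ⊨ φ))

Satisfiable : {n : ℕ} → Form n → Set₁
Satisfiable {n} φ =
  Σ (MCM n) λ Γ → Σ State λ s → Σ (State → Fin n) λ f →
    S Γ s × Φ Γ f × (Γ , s , f ⊨ φ)

-- A dynamic formula [χ]ψ only shrinks the set of classifiers to those on which χ holds
-- at every input, so announcements can be compiled away by relativising □F to a guard
-- that accumulates them.  This leaves static formulas, whose models are grids S × Φ in
-- which □I ranges over a column (fixed classifier) and □F over a row (fixed input).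
-- A static formula ψ₀ is satisfiable iff some set P of types (the atoms of ψ₀, the
-- output value, and truth values for the boxed subformulas) is a quasimodel: every false
-- box is refuted on its line, every true box has its body true, and every row of P meets
-- every column.  Quasimodels are finite objects, hence can be searched for.  From a
-- quasimodel one builds a finite grid whose rows and columns are the types of P, each
-- taken twice; conversely, classically, the types realised in a model form a quasimodel,
-- and since being a quasimodel is decidable this double-negated argument suffices.

module Submission where

open import Defs
open import Data.Bool as Bool using (Bool; true; false; T)
open import Data.Bool.Properties using (T-≡; not-¬)
open import Data.Empty using (⊥-elim)
open import Data.Fin as Fin using (Fin; toℕ)
open import Data.Fin.Properties using (any?; toℕ-injective)
open import Data.List
  using (List; []; _∷_; [_]; map; _++_; length; lookup; cartesianProduct; allFin)
open import Data.List.Membership.Propositional using (_∈_; find; lose)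
open import Data.List.Membership.Propositional.Properties
  using (∈-map⁺; ∈-++⁺ˡ; ∈-++⁺ʳ; ∈-cartesianProduct⁺; ∈-cartesianProduct⁻; ∈-allFin; ∈-lookup)
open import Data.List.Relation.Unary.All as All using (All)
open import Data.List.Relation.Unary.Any as Any using (Any; here; there)
open import Data.List.Relation.Unary.Any.Properties using (lookup-index)
open import Data.Nat as ℕ using (ℕ; zero; suc; _+_; _<_; _⊔_; s≤s)
open import Data.Nat.Properties using (≤-<-trans; m≤m⊔n; m≤n⊔m; ≤-refl)
open import Data.Product using (Σ; _×_; _,_; proj₁; proj₂; uncurry)
open import Data.Product.Function.NonDependent.Propositional using (_×-⇔_)
open import Data.Unit using (⊤; tt)
open import Data.Vec using (Vec; []; _∷_; tabulate)
import Data.Vec.Properties as Vec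
open import Effect.Monad using (RawMonad)
open import Function using (_∘_; _⇔_; mk⇔; Equivalence)
open import Function.Properties.Equivalence using ()
  renaming (refl to ⇔-refl; sym to ⇔-sym; trans to ⇔-trans)
open import Function.Related.TypeIsomorphisms using (¬-cong-⇔; →-cong-⇔)
open import Level using (0ℓ)
open import Relation.Binary.PropositionalEquality using (_≡_; refl; sym; trans; cong; subst)
open import Relation.Nullary using (¬_; Dec; yes; no; _×-dec_; _→-dec_; ¬?; contradiction)
open import Relation.Nullary.Decidable as Dec
  using (T?; map′; ⌊_⌋; toWitness; fromWitness; decidable-stable; ¬¬-excluded-middle)
open import Relation.Nullary.Negation using (Stable; negated-stable; ¬¬-map; ¬¬-Monad)

open Equivalence using (to; from)
open RawMonad (¬¬-Monad {0ℓ})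

variable
  n : ℕ

data Modality : Set where
  input classifier : Modality

data SForm (n : ℕ) : Set where
  atom : ℕ → SForm n
  t    : Fin n → SForm n
  ¬'   : SForm n → SForm n
  _∧'_ : SForm n → SForm n → SForm n
  □    : Modality → SForm n → SForm n

⌜_⌝ : SForm n → Form n
⌜ atom p ⌝           = atom p
⌜ t x ⌝              = t x
⌜ ¬' φ ⌝             = ¬' ⌜ φ ⌝
⌜ φ ∧' ψ ⌝           = ⌜ φ ⌝ ∧' ⌜ ψ ⌝
⌜ □ input φ ⌝        = □I ⌜ φ ⌝
⌜ □ classifier φ ⌝   = □F ⌜ φ ⌝

_⇒'_ : SForm n → SForm n → SForm n
φ ⇒' ψ = ¬' (φ ∧' ¬' ψ)

⊤' : SForm n
⊤' = ¬' (atom 0 ∧' ¬' (atom 0))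

⊨-stable : ∀ (Γ : MCM n) s f φ → Stable (Γ , s , f ⊨ ⌜ φ ⌝)
⊨-stable Γ s f (atom p)         = decidable-stable (s p Bool.≟ true)
⊨-stable Γ s f (t x)            = decidable-stable (f s Fin.≟ x)
⊨-stable Γ s f (¬' φ)           = negated-stable
⊨-stable Γ s f (φ ∧' ψ) ¬¬φψ    =
  ⊨-stable Γ s f φ (¬¬-map proj₁ ¬¬φψ) , ⊨-stable Γ s f ψ (¬¬-map proj₂ ¬¬φψ)
⊨-stable Γ s f (□ input φ) ¬¬□φ s′ s′∈S =
  ⊨-stable Γ s′ f φ (¬¬-map (λ □φ → □φ s′ s′∈S) ¬¬□φ)
⊨-stable Γ s f (□ classifier φ) ¬¬□φ f′ f′∈Φ =
  ⊨-stable Γ s f′ φ (¬¬-map (λ □φ → □φ f′ f′∈Φ) ¬¬□φ)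

_≃_ : MCM n → MCM n → Set
Γ ≃ Δ = (∀ s → S Γ s ⇔ S Δ s) × (∀ f → Φ Γ f ⇔ Φ Δ f)

∀∈-cong : ∀ {A : Set} {P Q B C : A → Set} → (∀ x → P x ⇔ Q x) → (∀ x → B x ⇔ C x) →
          (∀ x → P x → B x) ⇔ (∀ x → Q x → C x)
∀∈-cong P⇔Q B⇔C = mk⇔ (λ h x q → to (B⇔C x) (h x (from (P⇔Q x) q)))
                      (λ h x p → from (B⇔C x) (h x (to (P⇔Q x) p)))

mutual
  ⊨-resp-≃ : {Γ Δ : MCM n} → Γ ≃ Δ → ∀ φ s f → (Γ , s , f ⊨ φ) ⇔ (Δ , s , f ⊨ φ)
  ⊨-resp-≃ Γ≃Δ (atom p)  s f = ⇔-refl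
  ⊨-resp-≃ Γ≃Δ (t x)     s f = ⇔-refl
  ⊨-resp-≃ Γ≃Δ (¬' φ)    s f = ¬-cong-⇔ (⊨-resp-≃ Γ≃Δ φ s f)
  ⊨-resp-≃ Γ≃Δ (φ ∧' ψ)  s f = ⊨-resp-≃ Γ≃Δ φ s f ×-⇔ ⊨-resp-≃ Γ≃Δ ψ s f
  ⊨-resp-≃ Γ≃Δ (□I φ)    s f = ∀∈-cong (proj₁ Γ≃Δ) (λ s′ → ⊨-resp-≃ Γ≃Δ φ s′ f)
  ⊨-resp-≃ Γ≃Δ (□F φ)    s f = ∀∈-cong (proj₂ Γ≃Δ) (λ f′ → ⊨-resp-≃ Γ≃Δ φ s f′)
  ⊨-resp-≃ Γ≃Δ ([ φ ] ψ) s f =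
    →-cong-⇔ (∀∈-cong (proj₁ Γ≃Δ) (λ s′ → ⊨-resp-≃ Γ≃Δ φ s′ f))
             (⊨-resp-≃ (update-resp-≃ Γ≃Δ φ) ψ s f)

  update-resp-≃ : {Γ Δ : MCM n} → Γ ≃ Δ → ∀ φ → update Γ φ ≃ update Δ φ
  update-resp-≃ Γ≃Δ φ =
    proj₁ Γ≃Δ , λ f → proj₂ Γ≃Δ f ×-⇔ ∀∈-cong (proj₁ Γ≃Δ) (λ s′ → ⊨-resp-≃ Γ≃Δ φ s′ f)

⊨-⇒ : ∀ (Γ : MCM n) s f φ ψ →
      (Γ , s , f ⊨ ⌜ φ ⇒' ψ ⌝) ⇔ (Γ , s , f ⊨ ⌜ φ ⌝ → Γ , s , f ⊨ ⌜ ψ ⌝)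
⊨-⇒ Γ s f φ ψ = mk⇔ (λ φ⇒ψ φ → ⊨-stable Γ s f ψ (λ ¬ψ → φ⇒ψ (φ , ¬ψ)))
                    (λ φ→ψ (φ , ¬ψ) → ¬ψ (φ→ψ φ))

-- The guard g collects the announcements made so far: after them, the surviving
-- classifiers are those of the original model on which □I g holds.
static : SForm n → Form n → SForm n
static g (atom p)  = atom p
static g (t x)     = t x
static g (¬' φ)    = ¬' (static g φ)
static g (φ ∧' ψ)  = static g φ ∧' static g ψ
static g (□I φ)    = □ input (static g φ)
static g (□F φ)    = □ classifier (□ input g ⇒' static g φ)
static g ([ χ ] ψ) = □ input (static g χ) ⇒' static (g ∧' static g χ) ψ

update-⊤ : (Γ : MCM n) → Γ ≃ update Γ ⌜ ⊤' ⌝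
update-⊤ Γ = (λ s → ⇔-refl) , λ f → mk⇔ (λ f∈Φ → f∈Φ , λ _ _ (p , ¬p) → ¬p p) proj₁

update-update : ∀ (Γ : MCM n) g χ χ′ →
                (∀ s f → (update Γ ⌜ g ⌝ , s , f ⊨ χ) ⇔ (Γ , s , f ⊨ ⌜ χ′ ⌝)) →
                update (update Γ ⌜ g ⌝) χ ≃ update Γ ⌜ g ∧' χ′ ⌝
update-update Γ g χ χ′ χ⇔χ′ = (λ s → ⇔-refl) , λ f → mk⇔
  (λ ((f∈Φ , □g) , □χ) → f∈Φ , λ s′ s′∈S → □g s′ s′∈S , to (χ⇔χ′ s′ f) (□χ s′ s′∈S))
  (λ (f∈Φ , □gχ′) → (f∈Φ , λ s′ s′∈S → proj₁ (□gχ′ s′ s′∈S)) ,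
                     λ s′ s′∈S → from (χ⇔χ′ s′ f) (proj₂ (□gχ′ s′ s′∈S)))

static-correct : ∀ φ g (Γ : MCM n) s f →
                 (update Γ ⌜ g ⌝ , s , f ⊨ φ) ⇔ (Γ , s , f ⊨ ⌜ static g φ ⌝)
static-correct (atom p) g Γ s f = ⇔-refl
static-correct (t x)    g Γ s f = ⇔-refl
static-correct (¬' φ)   g Γ s f = ¬-cong-⇔ (static-correct φ g Γ s f)
static-correct (φ ∧' ψ) g Γ s f = static-correct φ g Γ s f ×-⇔ static-correct ψ g Γ s f
static-correct (□I φ)   g Γ s f = ∀∈-cong (λ s′ → ⇔-refl) (λ s′ → static-correct φ g Γ s′ f)
static-correct (□F φ)   g Γ s f = mk⇔
  (λ □φ f′ f′∈Φ → from (⊨-⇒ Γ s f′ (□ input g) (static g φ))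
     (λ □g → to (static-correct φ g Γ s f′) (□φ f′ (f′∈Φ , □g))))
  (λ □φ f′ (f′∈Φ , □g) → from (static-correct φ g Γ s f′)
     (to (⊨-⇒ Γ s f′ (□ input g) (static g φ)) (□φ f′ f′∈Φ) □g))
static-correct ([ χ ] ψ) g Γ s f =
  ⇔-trans (→-cong-⇔ (∀∈-cong (λ s′ → ⇔-refl) (λ s′ → χ⇔χ′ s′ f))
                    (⇔-trans (⊨-resp-≃ (update-update Γ g χ χ′ χ⇔χ′) ψ s f)
                             (static-correct ψ (g ∧' χ′) Γ s f)))
          (⇔-sym (⊨-⇒ Γ s f (□ input χ′) (static (g ∧' χ′) ψ)))
  where
  χ′ = static g χ
  χ⇔χ′ : ∀ s f → (update Γ ⌜ g ⌝ , s , f ⊨ χ) ⇔ (Γ , s , f ⊨ ⌜ χ′ ⌝)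
  χ⇔χ′ s f = static-correct χ g Γ s f

satisfiable-static : (φ : Form n) → Satisfiable φ ⇔ Satisfiable ⌜ static ⊤' φ ⌝
satisfiable-static φ = mk⇔
  (λ (Γ , s , f , s∈S , f∈Φ , ⊨φ) → Γ , s , f , s∈S , f∈Φ ,
     to (static-correct φ ⊤' Γ s f) (to (⊨-resp-≃ (update-⊤ Γ) φ s f) ⊨φ))
  (λ (Γ , s , f , s∈S , f∈Φ , ⊨φ′) → Γ , s , f , s∈S , f∈Φ ,
     from (⊨-resp-≃ (update-⊤ Γ) φ s f) (from (static-correct φ ⊤' Γ s f) ⊨φ′))

_≟ᴹ_ : (m m′ : Modality) → Dec (m ≡ m′)
input      ≟ᴹ input      = yes refl
input      ≟ᴹ classifier = no λ ()
classifier ≟ᴹ input      = no λ ()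
classifier ≟ᴹ classifier = yes refl

maxAtom : SForm n → ℕ
maxAtom (atom p) = p
maxAtom (t x)    = 0
maxAtom (¬' φ)   = maxAtom φ
maxAtom (φ ∧' ψ) = maxAtom φ ⊔ maxAtom ψ
maxAtom (□ m φ)  = maxAtom φ

maxAtom-∧ˡ : ∀ {k} (φ ψ : SForm n) → maxAtom (φ ∧' ψ) < k → maxAtom φ < k
maxAtom-∧ˡ φ ψ = ≤-<-trans (m≤m⊔n (maxAtom φ) (maxAtom ψ))

maxAtom-∧ʳ : ∀ {k} (φ ψ : SForm n) → maxAtom (φ ∧' ψ) < k → maxAtom ψ < k
maxAtom-∧ʳ φ ψ = ≤-<-trans (m≤n⊔m (maxAtom φ) (maxAtom ψ))

Annotation : SForm n → Set
Annotation (atom p) = ⊤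
Annotation (t x)    = ⊤
Annotation (¬' φ)   = Annotation φ
Annotation (φ ∧' ψ) = Annotation φ × Annotation ψ
Annotation (□ m φ)  = Bool × Annotation φ

Agree : Modality → (φ : SForm n) → Annotation φ → Annotation φ → Set
Agree m (atom p)  _        _        = ⊤
Agree m (t x)     _        _        = ⊤
Agree m (¬' φ)    a        a′       = Agree m φ a a′
Agree m (φ ∧' ψ)  (a , b)  (a′ , b′) = Agree m φ a a′ × Agree m ψ b b′
Agree m (□ m′ φ)  (x , a)  (x′ , a′) = (m ≡ m′ → x ≡ x′) × Agree m φ a a′

Agree-refl : ∀ m (φ : SForm n) a → Agree m φ a a
Agree-refl m (atom p) _       = tt
Agree-refl m (t x)    _       = tt
Agree-refl m (¬' φ)   a       = Agree-refl m φ a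
Agree-refl m (φ ∧' ψ) (a , b) = Agree-refl m φ a , Agree-refl m ψ b
Agree-refl m (□ m′ φ) (x , a) = (λ _ → refl) , Agree-refl m φ a

Agree-sym : ∀ m (φ : SForm n) {a a′} → Agree m φ a a′ → Agree m φ a′ a
Agree-sym m (atom p) _         = tt
Agree-sym m (t x)    _         = tt
Agree-sym m (¬' φ)   g         = Agree-sym m φ g
Agree-sym m (φ ∧' ψ) (g , h)   = Agree-sym m φ g , Agree-sym m ψ h
Agree-sym m (□ m′ φ) (x≡ , g)  = sym ∘ x≡ , Agree-sym m φ g

Agree-trans : ∀ m (φ : SForm n) {a a′ a″} → Agree m φ a a′ → Agree m φ a′ a″ → Agree m φ a a″
Agree-trans m (atom p) _          _          = tt
Agree-trans m (t x)    _          _          = tt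
Agree-trans m (¬' φ)   g          h          = Agree-trans m φ g h
Agree-trans m (φ ∧' ψ) (g , g′)   (h , h′)   = Agree-trans m φ g h , Agree-trans m ψ g′ h′
Agree-trans m (□ m′ φ) (x≡ , g)   (y≡ , h)   = (λ e → trans (x≡ e) (y≡ e)) , Agree-trans m φ g h

Agree? : ∀ m (φ : SForm n) a a′ → Dec (Agree m φ a a′)
Agree? m (atom p) _        _         = yes tt
Agree? m (t x)    _        _         = yes tt
Agree? m (¬' φ)   a        a′        = Agree? m φ a a′
Agree? m (φ ∧' ψ) (a , b)  (a′ , b′) = Agree? m φ a a′ ×-dec Agree? m ψ b b′
Agree? m (□ m′ φ) (x , a)  (x′ , a′) = ((m ≟ᴹ m′) →-dec (x Bool.≟ x′)) ×-dec Agree? m φ a a′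

prepend : ∀ {k} → Vec Bool k → (ℕ → Bool) → ℕ → Bool
prepend []      g p       = g p
prepend (b ∷ v) g zero    = b
prepend (b ∷ v) g (suc p) = prepend v g p

prepend-+ : ∀ {k} (v : Vec Bool k) g x → prepend v g (k + x) ≡ g x
prepend-+ []      g x = refl
prepend-+ (b ∷ v) g x = prepend-+ v g x

prepend-< : ∀ {k} (v : Vec Bool k) g g′ {p} → p < k → prepend v g p ≡ prepend v g′ p
prepend-< (b ∷ v) g g′ {zero}  _         = refl
prepend-< (b ∷ v) g g′ {suc p} (s≤s p<k) = prepend-< v g g′ p<k

prepend-tabulate : ∀ {k} (s : ℕ → Bool) g {p} → p < k →
                   prepend (tabulate {n = k} (s ∘ toℕ)) g p ≡ s p
prepend-tabulate {suc k} s g {zero}  _         = refl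
prepend-tabulate {suc k} s g {suc p} (s≤s p<k) = prepend-tabulate (s ∘ suc) g p<k

Holds : ∀ {k} → Vec Bool k → Fin n → (φ : SForm n) → Annotation φ → Set
Holds v x (atom p) _       = T (prepend v (λ _ → false) p)
Holds v x (t y)    _       = x ≡ y
Holds v x (¬' φ)   a       = ¬ Holds v x φ a
Holds v x (φ ∧' ψ) (a , b) = Holds v x φ a × Holds v x ψ b
Holds v x (□ m φ)  (b , _) = T b

holds? : ∀ {k} (v : Vec Bool k) (x : Fin n) φ a → Dec (Holds v x φ a)
holds? v x (atom p) _       = T? _
holds? v x (t y)    _       = x Fin.≟ y
holds? v x (¬' φ)   a       = ¬? (holds? v x φ a)
holds? v x (φ ∧' ψ) (a , b) = holds? v x φ a ×-dec holds? v x ψ b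
holds? v x (□ m φ)  (b , _) = T? b

Enumeration : Set → Set
Enumeration A = Σ (List A) λ xs → ∀ x → x ∈ xs

enum-⊤ : Enumeration ⊤
enum-⊤ = [ tt ] , λ _ → here refl

enum-Bool : Enumeration Bool
enum-Bool = true ∷ false ∷ [] , λ { true → here refl ; false → there (here refl) }

enum-Fin : ∀ k → Enumeration (Fin k)
enum-Fin k = allFin k , ∈-allFin

enum-× : ∀ {A B} → Enumeration A → Enumeration B → Enumeration (A × B)
enum-× (xs , ∈xs) (ys , ∈ys) =
  cartesianProduct xs ys , λ (x , y) → ∈-cartesianProduct⁺ (∈xs x) (∈ys y)

enum-Vec : ∀ {A} → Enumeration A → ∀ k → Enumeration (Vec A k)
enum-Vec E zero    = [ [] ] , λ { [] → here refl }
enum-Vec E (suc k) =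
  map (uncurry _∷_) (proj₁ E×) , λ { (x ∷ v) → ∈-map⁺ (uncurry _∷_) (proj₂ E× (x , v)) }
  where E× = enum-× E (enum-Vec E k)

enum-Annotation : (φ : SForm n) → Enumeration (Annotation φ)
enum-Annotation (atom p) = enum-⊤
enum-Annotation (t x)    = enum-⊤
enum-Annotation (¬' φ)   = enum-Annotation φ
enum-Annotation (φ ∧' ψ) = enum-× (enum-Annotation φ) (enum-Annotation ψ)
enum-Annotation (□ m φ)  = enum-× enum-Bool (enum-Annotation φ)

sublists : ∀ {A : Set} → List A → List (List A)
sublists []       = [ [] ]
sublists (x ∷ xs) = map (x ∷_) (sublists xs) ++ sublists xs

record Selection {A : Set} (Q : A → Set) (xs : List A) : Set where
  field
    members  : List A
    sublist  : members ∈ sublists xs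
    sound    : ∀ {y} → y ∈ members → Q y
    complete : ∀ {x} → x ∈ xs → Q x → x ∈ members

¬¬-selection : ∀ {A : Set} (Q : A → Set) xs → ¬ ¬ Selection Q xs
¬¬-selection Q []       =
  pure (record { members = [] ; sublist = here refl ; sound = λ () ; complete = λ () })
¬¬-selection Q (x ∷ xs) = do
  sel ← ¬¬-selection Q xs
  Qx? ← ¬¬-excluded-middle
  pure (extend sel Qx?)
  where
  extend : Selection Q xs → Dec (Q x) → Selection Q (x ∷ xs)
  extend sel (yes q) = record
    { members  = x ∷ members
    ; sublist  = ∈-++⁺ˡ (∈-map⁺ (x ∷_) sublist)
    ; sound    = λ { (here refl) → q ; (there y∈) → sound y∈ }
    ; complete = λ { (here refl) _ → here refl ; (there z∈) qz → there (complete z∈ qz) }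
    }
    where open Selection sel
  extend sel (no ¬q) = record
    { members  = members
    ; sublist  = ∈-++⁺ʳ _ sublist
    ; sound    = sound
    ; complete = λ { (here refl) qx → contradiction qx ¬q ; (there z∈) qz → complete z∈ qz }
    }
    where open Selection sel

T-⇔⇒≡ : ∀ {b b′} → T b ⇔ T b′ → b ≡ b′
T-⇔⇒≡ {false} {false} _ = refl
T-⇔⇒≡ {false} {true}  e = ⊥-elim (from e tt)
T-⇔⇒≡ {true}  {false} e = ⊥-elim (to e tt)
T-⇔⇒≡ {true}  {true}  _ = refl

module Quasimodels {n : ℕ} (ψ₀ : SForm n) where

  K : ℕ
  K = suc (maxAtom ψ₀)

  Type : Set
  Type = Vec Bool K × Fin n × Annotation ψ₀

  atoms : Type → Vec Bool K
  atoms = proj₁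

  value : Type → Fin n
  value = proj₁ ∘ proj₂

  annot : Type → Annotation ψ₀
  annot = proj₂ ∘ proj₂

  HoldsAt : Type → (φ : SForm n) → Annotation φ → Set
  HoldsAt τ = Holds (atoms τ) (value τ)

  types : Enumeration Type
  types = enum-× (enum-Vec enum-Bool K) (enum-× (enum-Fin n) (enum-Annotation ψ₀))

  -- Line input relates types that may occur at two inputs under one classifier, i.e. in
  -- one column of a grid; Line classifier types that may occur in one row.
  data Line : Modality → Type → Type → Set where
    column : ∀ {τ τ′} → Agree input ψ₀ (annot τ) (annot τ′) → Line input τ τ′
    row    : ∀ {τ τ′} → atoms τ ≡ atoms τ′ → Agree classifier ψ₀ (annot τ) (annot τ′) →
             Line classifier τ τ′

  Line⇒Agree : ∀ {m τ τ′} → Line m τ τ′ → Agree m ψ₀ (annot τ) (annot τ′)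
  Line⇒Agree (column a) = a
  Line⇒Agree (row _ a)  = a

  Line-refl : ∀ m {τ} → Line m τ τ
  Line-refl input      = column (Agree-refl input ψ₀ _)
  Line-refl classifier = row refl (Agree-refl classifier ψ₀ _)

  Line-sym : ∀ {m τ τ′} → Line m τ τ′ → Line m τ′ τ
  Line-sym (column a) = column (Agree-sym input ψ₀ a)
  Line-sym (row e a)  = row (sym e) (Agree-sym classifier ψ₀ a)

  Line-trans : ∀ {m τ τ′ τ″} → Line m τ τ′ → Line m τ′ τ″ → Line m τ τ″
  Line-trans (column a) (column a′) = column (Agree-trans input ψ₀ a a′)
  Line-trans (row e a)  (row e′ a′) = row (trans e e′) (Agree-trans classifier ψ₀ a a′)

  Line? : ∀ m τ τ′ → Dec (Line m τ τ′)
  Line? input τ τ′ = map′ column Line⇒Agree (Agree? input ψ₀ (annot τ) (annot τ′))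
  Line? classifier τ τ′ =
    map′ (λ (e , a) → row e a) (λ { (row e a) → e , a })
         (Vec.≡-dec Bool._≟_ (atoms τ) (atoms τ′) ×-dec Agree? classifier ψ₀ (annot τ) (annot τ′))

  module _ (P : List Type) where

    -- A selector e : Type → Annotation φ reads off, in every type, the annotation of one
    -- occurrence of φ in ψ₀.
    Refuted : Modality → (φ : SForm n) → (Type → Annotation φ) → Type → Set
    Refuted m φ e τ = Any (λ τ′ → Line m τ τ′ × ¬ HoldsAt τ′ φ (e τ′)) P

    refuted? : ∀ m φ e τ → Dec (Refuted m φ e τ)
    refuted? m φ e τ =
      Any.any? (λ τ′ → Line? m τ τ′ ×-dec ¬? (holds? (atoms τ′) (value τ′) φ (e τ′))) P

    Witnessed : Modality → (φ : SForm n) → (Type → Bool × Annotation φ) → Type → Set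
    Witnessed m φ e τ =
      (T (proj₁ (e τ)) → HoldsAt τ φ (proj₂ (e τ))) ×
      (¬ T (proj₁ (e τ)) → Refuted m φ (proj₂ ∘ e) τ)

    Saturated : (φ : SForm n) → (Type → Annotation φ) → Set
    Saturated (atom p) e = ⊤
    Saturated (t x)    e = ⊤
    Saturated (¬' φ)   e = Saturated φ e
    Saturated (φ ∧' ψ) e = Saturated φ (proj₁ ∘ e) × Saturated ψ (proj₂ ∘ e)
    Saturated (□ m φ)  e = All (Witnessed m φ e) P × Saturated φ (proj₂ ∘ e)

    Meets : Type → Type → Type → Set
    Meets τ σ ρ = Line classifier ρ τ × Line input ρ σ

    meets? : ∀ τ σ ρ → Dec (Meets τ σ ρ)
    meets? τ σ ρ = Line? classifier ρ τ ×-dec Line? input ρ σ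

    Rectangular : Set
    Rectangular = All (λ τ → All (λ σ → Any (Meets τ σ) P) P) P

    Satisfied : Set
    Satisfied = Any (λ τ → HoldsAt τ ψ₀ (annot τ)) P

    satisfied? : Dec Satisfied
    satisfied? = Any.any? (λ τ → holds? (atoms τ) (value τ) ψ₀ (annot τ)) P

    record IsQuasimodel : Set where
      field
        saturated   : Saturated ψ₀ annot
        rectangular : Rectangular
        satisfied   : Satisfied

    witnessed? : ∀ m φ e τ → Dec (Witnessed m φ e τ)
    witnessed? m φ e τ =
      (T? _ →-dec holds? (atoms τ) (value τ) φ _) ×-dec
      (¬? (T? _) →-dec refuted? m φ (proj₂ ∘ e) τ)

    saturated? : ∀ φ e → Dec (Saturated φ e)
    saturated? (atom p) e = yes tt
    saturated? (t x)    e = yes tt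
    saturated? (¬' φ)   e = saturated? φ e
    saturated? (φ ∧' ψ) e = saturated? φ _ ×-dec saturated? ψ _
    saturated? (□ m φ)  e = All.all? (witnessed? m φ e) P ×-dec saturated? φ _

    isQuasimodel? : Dec IsQuasimodel
    isQuasimodel? =
      map′ (λ (s , r , i) → record { saturated = s ; rectangular = r ; satisfied = i })
           (λ q → let open IsQuasimodel q in saturated , rectangular , satisfied)
           (saturated? ψ₀ annot ×-dec
            All.all? (λ τ → All.all? (λ σ → Any.any? (meets? τ σ) P) P) P ×-dec
            satisfied?)

  Coherent : (φ : SForm n) → (Type → Annotation φ) → Set
  Coherent φ e = ∀ m {τ τ′} → Line m τ τ′ → Agree m φ (e τ) (e τ′)

  module Grid (P : List Type) (qm : IsQuasimodel P) where
    open IsQuasimodel qm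

    Meets∈ : Type → Type → Type → Set
    Meets∈ τ σ ρ = ρ ∈ P × Meets P τ σ ρ

    meet : Type → Type → Type
    meet τ σ with Any.any? (meets? P τ σ) P
    ... | yes ∃ρ = proj₁ (find ∃ρ)
    ... | no _   = τ

    meet-meets : ∀ {τ σ} → τ ∈ P → σ ∈ P → Meets∈ τ σ (meet τ σ)
    meet-meets {τ} {σ} τ∈ σ∈ with Any.any? (meets? P τ σ) P
    ... | yes ∃ρ = proj₂ (find ∃ρ)
    ... | no ∄ρ  = contradiction (All.lookup (All.lookup rectangular τ∈) σ∈) ∄ρ

    Label : Set
    Label = Type × Bool

    -- The tags make every type of P that lies on the row of τ occur in that row, and
    -- likewise for columns: when σ is on the row of τ and τ on the column of σ,
    -- equal tags put σ in the cell and unequal tags put τ.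
    cell : Label → Label → Type
    cell (τ , k) (σ , l) with k Bool.≟ l | Line? classifier σ τ | Line? input τ σ
    ... | yes _ | yes _ | _     = σ
    ... | yes _ | no _  | yes _ = τ
    ... | yes _ | no _  | no _  = meet τ σ
    ... | no _  | _     | yes _ = τ
    ... | no _  | yes _ | no _  = σ
    ... | no _  | no _  | no _  = meet τ σ

    cell-meets : ∀ {τ σ} k l → τ ∈ P → σ ∈ P → Meets∈ τ σ (cell (τ , k) (σ , l))
    cell-meets {τ} {σ} k l τ∈ σ∈ with k Bool.≟ l | Line? classifier σ τ | Line? input τ σ
    ... | yes _ | yes ℓ | _     = σ∈ , ℓ , Line-refl input
    ... | yes _ | no _  | yes ℓ = τ∈ , Line-refl classifier , ℓ
    ... | yes _ | no _  | no _  = meet-meets τ∈ σ∈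
    ... | no _  | _     | yes ℓ = τ∈ , Line-refl classifier , ℓ
    ... | no _  | yes ℓ | no _  = σ∈ , ℓ , Line-refl input
    ... | no _  | no _  | no _  = meet-meets τ∈ σ∈

    cell-row : ∀ {τ σ} k → Line classifier σ τ → cell (τ , k) (σ , k) ≡ σ
    cell-row {τ} {σ} k ℓ with k Bool.≟ k | Line? classifier σ τ | Line? input τ σ
    ... | yes _  | yes _ | _ = refl
    ... | yes _  | no ¬ℓ | _ = contradiction ℓ ¬ℓ
    ... | no k≢k | _     | _ = contradiction refl k≢k

    cell-column : ∀ {τ σ} l → Line input τ σ → cell (τ , Bool.not l) (σ , l) ≡ τ
    cell-column {τ} {σ} l ℓ with Bool.not l Bool.≟ l | Line? classifier σ τ | Line? input τ σ
    ... | yes e | _ | _     = contradiction (sym e) (not-¬ refl)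
    ... | no _  | _ | yes _ = refl
    ... | no _  | _ | no ¬ℓ = contradiction ℓ ¬ℓ

    labels : List Label
    labels = cartesianProduct P (proj₁ enum-Bool)

    Index : Set
    Index = Fin (length labels)

    labelType : Index → Type
    labelType = proj₁ ∘ lookup labels

    labelType-∈ : ∀ i → labelType i ∈ P
    labelType-∈ i = proj₁ (∈-cartesianProduct⁻ P _ (∈-lookup i))

    Cell : Set
    Cell = Index × Index

    type : Cell → Type
    type (r , j) = cell (lookup labels r) (lookup labels j)

    type-meets : ∀ c → Meets∈ (labelType (proj₁ c)) (labelType (proj₂ c)) (type c)
    type-meets (r , j) =
      cell-meets (proj₂ (lookup labels r)) (proj₂ (lookup labels j)) (labelType-∈ r) (labelType-∈ j)

    type-∈ : ∀ c → type c ∈ P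
    type-∈ c = proj₁ (type-meets c)

    type-in-row : ∀ c → Line classifier (type c) (labelType (proj₁ c))
    type-in-row c = proj₁ (proj₂ (type-meets c))

    type-in-column : ∀ c → Line input (type c) (labelType (proj₂ c))
    type-in-column c = proj₂ (proj₂ (type-meets c))

    index-of : ∀ {τ} → τ ∈ P → (k : Bool) → Σ Index λ i → lookup labels i ≡ (τ , k)
    index-of τ∈ k = Any.index τk∈ , sym (lookup-index τk∈)
      where τk∈ = ∈-cartesianProduct⁺ τ∈ (proj₂ enum-Bool k)

    row-covered : ∀ r {τ} → τ ∈ P → Line classifier τ (labelType r) →
                  Σ Index λ j → type (r , j) ≡ τ
    row-covered r τ∈ ℓ with index-of τ∈ (proj₂ (lookup labels r))
    ... | j , label-j =
      j , trans (cong (cell (lookup labels r)) label-j) (cell-row (proj₂ (lookup labels r)) ℓ)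

    column-covered : ∀ j {τ} → τ ∈ P → Line input τ (labelType j) →
                     Σ Index λ r → type (r , j) ≡ τ
    column-covered j τ∈ ℓ with index-of τ∈ (Bool.not (proj₂ (lookup labels j)))
    ... | r , label-r =
      r , trans (cong (λ L → cell L (lookup labels j)) label-r)
                (cell-column (proj₂ (lookup labels j)) ℓ)

    along : Modality → Cell → Index → Cell
    along input      (r , j) r′ = r′ , j
    along classifier (r , j) j′ = r , j′

    along-line : ∀ m c i → Line m (type (along m c i)) (type c)
    along-line input (r , j) r′ =
      Line-trans (type-in-column (r′ , j)) (Line-sym (type-in-column (r , j)))
    along-line classifier (r , j) j′ =
      Line-trans (type-in-row (r , j′)) (Line-sym (type-in-row (r , j)))

    line-covered : ∀ m c {τ} → τ ∈ P → Line m τ (type c) → Σ Index λ i → type (along m c i) ≡ τ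
    line-covered input (r , j) τ∈ ℓ =
      column-covered j τ∈ (Line-trans ℓ (type-in-column (r , j)))
    line-covered classifier (r , j) τ∈ ℓ =
      row-covered r τ∈ (Line-trans ℓ (type-in-row (r , j)))

    -- Atoms beyond K are free; the atom K + i marks the states of row i.
    state : Index → State
    state r = prepend (atoms (labelType r)) (λ x → ⌊ x ℕ.≟ toℕ r ⌋)

    state-atom : ∀ r j {p} → p < K → state r p ≡ prepend (atoms (type (r , j))) (λ _ → false) p
    state-atom r j p<K with type-in-row (r , j)
    ... | row same-atoms _ =
      trans (prepend-< (atoms (labelType r)) _ _ p<K)
            (cong (λ v → prepend v (λ _ → false) _) (sym same-atoms))

    marked : State → Index → Set
    marked s r = T (s (K + toℕ r))

    marked-state : ∀ r {r′} → marked (state r) r′ → r′ ≡ r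
    marked-state r {r′} mark =
      toℕ-injective (toWitness (subst T (prepend-+ (atoms (labelType r)) _ (toℕ r′)) mark))

    state-marked : ∀ r → marked (state r) r
    state-marked r = subst T (sym (prepend-+ (atoms (labelType r)) _ (toℕ r))) (fromWitness refl)

    marked? : ∀ s → Dec (Σ Index (marked s))
    marked? s = any? (λ r → T? (s (K + toℕ r)))

    valueAt : ∀ {A : Index → Set} → Index → Dec (Σ Index A) → Fin n
    valueAt j (yes (r , _)) = value (type (r , j))
    valueAt j (no _)        = value (labelType j)

    classify : Index → State → Fin n
    classify j s = valueAt j (marked? s)

    classify-state : ∀ r j → classify j (state r) ≡ value (type (r , j))
    classify-state r j = valueAt-state (marked? (state r))
      where
      valueAt-state : (d : Dec (Σ Index (marked (state r)))) → valueAt j d ≡ value (type (r , j))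
      valueAt-state (yes (r′ , mark)) = cong (λ i → value (type (i , j))) (marked-state r mark)
      valueAt-state (no ∄mark)        = contradiction (r , state-marked r) ∄mark

    M : MCM n
    M = mcm (λ s → Σ Index λ r → s ≡ state r) (λ f → Σ Index λ j → f ≡ classify j)

    _⊨ᶜ_ : Cell → SForm n → Set
    (r , j) ⊨ᶜ φ = M , state r , classify j ⊨ ⌜ φ ⌝

    ⊨ᶜ-□ : ∀ m c φ → (c ⊨ᶜ □ m φ) ⇔ (∀ i → along m c i ⊨ᶜ φ)
    ⊨ᶜ-□ input      (r , j) φ =
      mk⇔ (λ □φ r′ → □φ (state r′) (r′ , refl)) (λ { □φ _ (r′ , refl) → □φ r′ })
    ⊨ᶜ-□ classifier (r , j) φ =
      mk⇔ (λ □φ j′ → □φ (classify j′) (j′ , refl)) (λ { □φ _ (j′ , refl) → □φ j′ })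

    truth : ∀ φ (e : Type → Annotation φ) → Coherent φ e → Saturated P φ e → maxAtom φ < K →
            ∀ c → (c ⊨ᶜ φ) ⇔ HoldsAt (type c) φ (e (type c))
    truth (atom p) e coh sat p<K (r , j) =
      mk⇔ (λ p∈s → from T-≡ (trans (sym (state-atom r j p<K)) p∈s))
          (λ p∈s → trans (state-atom r j p<K) (to T-≡ p∈s))
    truth (t x) e coh sat bound (r , j) =
      mk⇔ (trans (sym (classify-state r j))) (trans (classify-state r j))
    truth (¬' φ) e coh sat bound c = ¬-cong-⇔ (truth φ e coh sat bound c)
    truth (φ ∧' ψ) e coh (sat , sat′) bound c =
      truth φ (proj₁ ∘ e) (λ m ℓ → proj₁ (coh m ℓ)) sat (maxAtom-∧ˡ φ ψ bound) c ×-⇔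
      truth ψ (proj₂ ∘ e) (λ m ℓ → proj₂ (coh m ℓ)) sat′ (maxAtom-∧ʳ φ ψ bound) c
    truth (□ m φ) e coh (witnessed , sat) bound c = ⇔-trans (⊨ᶜ-□ m c φ) (mk⇔ necessary sufficient)
      where
      IH : ∀ c → (c ⊨ᶜ φ) ⇔ HoldsAt (type c) φ (proj₂ (e (type c)))
      IH = truth φ (proj₂ ∘ e) (λ m ℓ → proj₂ (coh m ℓ)) sat bound

      witnessed-at : ∀ c → Witnessed P m φ e (type c)
      witnessed-at c = All.lookup witnessed (type-∈ c)

      sufficient : T (proj₁ (e (type c))) → ∀ i → along m c i ⊨ᶜ φ
      sufficient □φ i = from (IH (along m c i))
        (proj₁ (witnessed-at (along m c i))
               (subst T (sym (proj₁ (coh m (along-line m c i)) refl)) □φ))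

      necessary : (∀ i → along m c i ⊨ᶜ φ) → T (proj₁ (e (type c)))
      necessary ⊨φ = decidable-stable (T? _) λ ¬□φ →
        let (τ′ , τ′∈ , ℓ , ¬φ) = find (proj₂ (witnessed-at c) ¬□φ)
            (i , type-i) = line-covered m c τ′∈ (Line-sym ℓ)
        in ¬φ (subst (λ τ → HoldsAt τ φ (proj₂ (e τ))) type-i (to (IH (along m c i)) (⊨φ i)))

    sound : Satisfiable ⌜ ψ₀ ⌝
    sound with find satisfied
    ... | τ₀ , τ₀∈ , ψ₀-holds with index-of τ₀∈ true
    ... | r₀ , label-r₀
        with row-covered r₀ τ₀∈
               (subst (Line classifier τ₀) (sym (cong proj₁ label-r₀)) (Line-refl classifier))
    ... | j₀ , type-c₀ =
      M , state r₀ , classify j₀ , (r₀ , refl) , (j₀ , refl) ,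
      from (truth ψ₀ annot (λ m → Line⇒Agree) saturated ≤-refl (r₀ , j₀))
           (subst (λ τ → HoldsAt τ ψ₀ (annot τ)) (sym type-c₀) ψ₀-holds)

  module Realisation (Γ : MCM n) where

    Point : Set
    Point = State × (State → Fin n)

    InΓ : Point → Set
    InΓ (s , f) = S Γ s × Φ Γ f

    _⊨ᵖ_ : Point → SForm n → Set
    (s , f) ⊨ᵖ φ = Γ , s , f ⊨ ⌜ φ ⌝

    data Aligned : Modality → Point → Point → Set where
      same-classifier : ∀ {s s′ f} → Aligned input (s , f) (s′ , f)
      same-input      : ∀ {s f f′} → Aligned classifier (s , f) (s , f′)

    aligned-refl : ∀ m {p} → Aligned m p p
    aligned-refl input      = same-classifier
    aligned-refl classifier = same-input

    □-aligned : ∀ {m p q} φ → Aligned m p q → (p ⊨ᵖ □ m φ) ⇔ (q ⊨ᵖ □ m φ)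
    □-aligned φ same-classifier = ⇔-refl
    □-aligned φ same-input      = ⇔-refl

    □-elim : ∀ {m p q} φ → InΓ q → Aligned m p q → p ⊨ᵖ □ m φ → q ⊨ᵖ φ
    □-elim φ (s∈S , _) (same-classifier {s′ = s′}) □φ = □φ s′ s∈S
    □-elim φ (_ , f∈Φ) (same-input {f′ = f′})      □φ = □φ f′ f∈Φ

    ¬□-witness : ∀ m {p} φ → InΓ p → ¬ (p ⊨ᵖ □ m φ) →
                 ¬ ¬ Σ Point λ q → InΓ q × Aligned m p q × ¬ (q ⊨ᵖ φ)
    ¬□-witness input {s , f} φ (_ , f∈Φ) ¬□φ ∄q = ¬□φ λ s′ s′∈S →
      ⊨-stable Γ s′ f φ λ ¬φ → ∄q ((s′ , f) , (s′∈S , f∈Φ) , same-classifier , ¬φ)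
    ¬□-witness classifier {s , f} φ (s∈S , _) ¬□φ ∄q = ¬□φ λ f′ f′∈Φ →
      ⊨-stable Γ s f′ φ λ ¬φ → ∄q ((s , f′) , (s∈S , f′∈Φ) , same-input , ¬φ)

    Faithful : (φ : SForm n) → Annotation φ → Point → Set
    Faithful (atom p) _       _ = ⊤
    Faithful (t x)    _       _ = ⊤
    Faithful (¬' φ)   a       p = Faithful φ a p
    Faithful (φ ∧' ψ) (a , b) p = Faithful φ a p × Faithful ψ b p
    Faithful (□ m φ)  (b , a) p = (T b ⇔ p ⊨ᵖ □ m φ) × Faithful φ a p

    ¬¬-faithful : ∀ φ p → ¬ ¬ Σ (Annotation φ) λ a → Faithful φ a p
    ¬¬-faithful (atom x) p = pure (tt , tt)
    ¬¬-faithful (t x)    p = pure (tt , tt)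
    ¬¬-faithful (¬' φ)   p = ¬¬-faithful φ p
    ¬¬-faithful (φ ∧' ψ) p = do
      a , faithful-a ← ¬¬-faithful φ p
      b , faithful-b ← ¬¬-faithful ψ p
      pure ((a , b) , faithful-a , faithful-b)
    ¬¬-faithful (□ m φ)  p = do
      □φ? ← ¬¬-excluded-middle
      a , faithful-a ← ¬¬-faithful φ p
      pure ((⌊ □φ? ⌋ , a) , mk⇔ toWitness fromWitness , faithful-a)

    faithful-agree : ∀ m φ {a a′ p q} → Aligned m p q → Faithful φ a p → Faithful φ a′ q →
                     Agree m φ a a′
    faithful-agree m (atom x) al _ _ = tt
    faithful-agree m (t x)    al _ _ = tt
    faithful-agree m (¬' φ)   al fa fa′ = faithful-agree m φ al fa fa′
    faithful-agree m (φ ∧' ψ) al (fa , fb) (fa′ , fb′) =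
      faithful-agree m φ al fa fa′ , faithful-agree m ψ al fb fb′
    faithful-agree m (□ m′ φ) al (b⇔ , fa) (b⇔′ , fa′) =
      (λ { refl → T-⇔⇒≡ (⇔-trans b⇔ (⇔-trans (□-aligned φ al) (⇔-sym b⇔′))) }) ,
      faithful-agree m φ al fa fa′

    tab : State → Vec Bool K
    tab s = tabulate (s ∘ toℕ)

    holds⇔⊨ : ∀ φ {a s f} → maxAtom φ < K → Faithful φ a (s , f) →
              Holds (tab s) (f s) φ a ⇔ (s , f) ⊨ᵖ φ
    holds⇔⊨ (atom p) {s = s} p<K _ =
      ⇔-trans T-≡ (mk⇔ (trans (sym (prepend-tabulate s _ p<K))) (trans (prepend-tabulate s _ p<K)))
    holds⇔⊨ (t x)    bound _ = ⇔-refl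
    holds⇔⊨ (¬' φ)   bound fa = ¬-cong-⇔ (holds⇔⊨ φ bound fa)
    holds⇔⊨ (φ ∧' ψ) bound (fa , fb) =
      holds⇔⊨ φ (maxAtom-∧ˡ φ ψ bound) fa ×-⇔ holds⇔⊨ ψ (maxAtom-∧ʳ φ ψ bound) fb
    holds⇔⊨ (□ m φ)  bound (b⇔ , _) = b⇔

    Realises : Point → Type → Set
    Realises (s , f) (v , x , a) = v ≡ tab s × x ≡ f s × Faithful ψ₀ a (s , f)

    ¬¬-realised : ∀ p → ¬ ¬ Σ Type (Realises p)
    ¬¬-realised (s , f) = do
      a , faithful-a ← ¬¬-faithful ψ₀ (s , f)
      pure ((tab s , f s , a) , refl , refl , faithful-a)

    realised-faithful : ∀ {p τ} → Realises p τ → Faithful ψ₀ (annot τ) p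
    realised-faithful {τ = v , x , a} (_ , _ , fa) = fa

    realised-holds : ∀ φ {a p τ} → Realises p τ → maxAtom φ < K → Faithful φ a p →
                     HoldsAt τ φ a ⇔ p ⊨ᵖ φ
    realised-holds φ {τ = _ , _ , _} (refl , refl , _) = holds⇔⊨ φ

    realised-line : ∀ {m p q τ τ′} → Aligned m p q → Realises p τ → Realises q τ′ → Line m τ τ′
    realised-line {τ = _ , _ , _} {_ , _ , _} same-classifier (_ , _ , fa) (_ , _ , fa′) =
      column (faithful-agree input ψ₀ same-classifier fa fa′)
    realised-line {τ = _ , _ , _} {_ , _ , _} same-input (e , _ , fa) (e′ , _ , fa′) =
      row (trans e (sym e′)) (faithful-agree classifier ψ₀ same-input fa fa′)

    Realised : Type → Set
    Realised τ = Σ Point λ p → InΓ p × Realises p τ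

    module _ (sel : Selection Realised (proj₁ types)) where
      open Selection sel renaming (members to P)

      realised-∈ : ∀ {p τ} → InΓ p → Realises p τ → τ ∈ P
      realised-∈ p∈Γ r = complete (proj₂ types _) (_ , p∈Γ , r)

      saturated : ∀ φ (e : Type → Annotation φ) → (∀ {p τ} → Realises p τ → Faithful φ (e τ) p) →
                  maxAtom φ < K → Saturated P φ e
      saturated (atom p) e faithful bound = tt
      saturated (t x)    e faithful bound = tt
      saturated (¬' φ)   e faithful bound = saturated φ e faithful bound
      saturated (φ ∧' ψ) e faithful bound =
        saturated φ (proj₁ ∘ e) (proj₁ ∘ faithful) (maxAtom-∧ˡ φ ψ bound) ,
        saturated ψ (proj₂ ∘ e) (proj₂ ∘ faithful) (maxAtom-∧ʳ φ ψ bound)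
      saturated (□ m φ)  e faithful bound =
        All.tabulate (λ τ∈ → witnessed (sound τ∈)) ,
        saturated φ (proj₂ ∘ e) (proj₂ ∘ faithful) bound
        where
        witnessed : ∀ {τ} → Realised τ → Witnessed P m φ e τ
        witnessed (p , p∈Γ , r) =
          (λ □φ → from (realised-holds φ r bound (proj₂ (faithful r)))
                       (□-elim φ p∈Γ (aligned-refl m) (to (proj₁ (faithful r)) □φ))) ,
          (λ ¬□φ → decidable-stable (refuted? P m φ (proj₂ ∘ e) _) do
             q , q∈Γ , al , ¬φ ← ¬□-witness m φ p∈Γ (¬□φ ∘ from (proj₁ (faithful r)))
             τ′ , r′ ← ¬¬-realised q
             pure (lose (realised-∈ q∈Γ r′)
                        (realised-line al r r′ ,
                         ¬φ ∘ to (realised-holds φ r′ bound (proj₂ (faithful r′))))))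

      rectangular : Rectangular P
      rectangular = All.tabulate λ τ∈ → All.tabulate λ σ∈ → meeting (sound τ∈) (sound σ∈)
        where
        meeting : ∀ {τ σ} → Realised τ → Realised σ → Any (Meets P τ σ) P
        meeting ((s , f) , (s∈S , _) , r) ((s′ , f′) , (_ , f′∈Φ) , r′) =
          decidable-stable (Any.any? (meets? P _ _) P) do
            ρ , rρ ← ¬¬-realised (s , f′)
            pure (lose (realised-∈ (s∈S , f′∈Φ) rρ)
                       (realised-line same-input rρ r , realised-line same-classifier rρ r′))

      satisfied : ∀ {p} → InΓ p → p ⊨ᵖ ψ₀ → Satisfied P
      satisfied {p} p∈Γ ⊨ψ₀ = decidable-stable (satisfied? P) do
        τ , r ← ¬¬-realised p
        pure (lose (realised-∈ p∈Γ r) (from (realised-holds ψ₀ r ≤-refl (realised-faithful r)) ⊨ψ₀))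

    ¬¬-quasimodel : ∀ {p} → InΓ p → p ⊨ᵖ ψ₀ → ¬ ¬ Any IsQuasimodel (sublists (proj₁ types))
    ¬¬-quasimodel p∈Γ ⊨ψ₀ = do
      sel ← ¬¬-selection Realised (proj₁ types)
      pure (lose (Selection.sublist sel) record
        { saturated   = saturated sel ψ₀ annot realised-faithful ≤-refl
        ; rectangular = rectangular sel
        ; satisfied   = satisfied sel p∈Γ ⊨ψ₀
        })

  decide : Dec (Satisfiable ⌜ ψ₀ ⌝)
  decide with Any.any? isQuasimodel? (sublists (proj₁ types))
  ... | yes ∃P = yes (Grid.sound _ (proj₂ (proj₂ (find ∃P))))
  ... | no ∄P  =
    no λ (Γ , s , f , s∈S , f∈Φ , ⊨ψ₀) → Realisation.¬¬-quasimodel Γ (s∈S , f∈Φ) ⊨ψ₀ ∄P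

theorem10 : (n : ℕ) → (φ : Form n) → Dec (Satisfiable φ)
theorem10 n φ = Dec.map (⇔-sym (satisfiable-static φ)) (Quasimodels.decide (static ⊤' φ))
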